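{- Let $C$ be a command, $(s,h)\in\mathcal{S}$, and let $O_1,O_2,L,D$ be sets of resource names such that $(O_1\cup O_2,L,D)$ and $(O_1,L\cup O_2,D)$ are resource configurations. If $C,(s,h,(O_1,L\cup O_2,D))\not\to_p\mathsf{abort}$, then $C,(s,h,(O_1\cup O_2,L,D))\not\to_p\mathsf{abort}$.
   Context: $\mathcal{S}$: pairs of a store $s:\mathbf{Var}\to\mathbf{Val}$ and a finite partial heap $h:\mathbf{Loc}\rightharpoonup\mathbf{Val}$. A resource configuration is a triple $\rho=(O,L,D)$ of pairwise disjoint sets of resource names; $r\in\rho$ iff $r\in O\cup L\cup D$; $\rho\setminus\{r\}$ componentwise removal. Commands: $\mathsf{skip}$, basic $c$ ($x:=e$, $x:=[e]$, $[e]:=e'$, $x:=\mathsf{cons}(\dots)$, $\mathsf{dispose}(e)$) with standard semantics $[c](s,h)$ (pair or $\mathsf{abort}$), $C_1;C_2$, conditionals, loops, $\mathsf{resource}\ r\ \mathsf{in}\ C$, $\mathsf{with}\ r\ \mathsf{when}\ B\ \mathsf{do}\ C$, $C_1\|C_2$, $\mathsf{within}\ r\ \mathsf{do}\ C$. $Locked(C_1;C_2)=Locked(C_1)$, $Locked(C_1\|C_2)=Locked(C_1)\cup Locked(C_2)$, $Locked(\mathsf{resource}\ r\ \mathsf{in}\ C)=Locked(C)\setminus\{r\}$, $Locked(\mathsf{within}\ r\ \mathsf{do}\ C)=Locked(C)\cup\{r\}$, else $\emptyset$. $C,(s,h,\rho)\to_p\mathsf{abort}$ is the least relation closed under: (RA)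 $\mathsf{resource}\ r\ \mathsf{in}\ C$ aborts if $r\in\rho$; (WA) $\mathsf{with}\ r\ \mathsf{when}\ B\ \mathsf{do}\ C$ aborts if $r\notin\rho$; (RA1) $\mathsf{resource}\ r\ \mathsf{in}\ C,(s,h,(O,L,D))$ aborts if $r\in Locked(C)$ and $C,(s,h,(O\cup\{r\},L,D))\to_p\mathsf{abort}$; (RA2) likewise if $r\notin Locked(C)$ and $C,(s,h,(O,L,D\cup\{r\}))\to_p\mathsf{abort}$; (BCA) $c$ aborts if $[c](s,h)=\mathsf{abort}$; (SA) $C_1;C_2$ aborts if $C_1$ does; (WA1) $\mathsf{within}\ r\ \mathsf{do}\ C,(s,h,\rho)$ aborts if $C,(s,h,\rho\setminus\{r\})\to_p\mathsf{abort}$; (WA2) $\mathsf{within}\ r\ \mathsf{do}\ C,(s,h,(O,L,D))$ aborts if $r\notin O$; (PA1/PA2) $C_1\|C_2$ aborts if $C_1$ or $C_2$ does. $\not\to_p\mathsf{abort}$ means this fails. -}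

module Defs where

open import Data.Nat using (ℕ; zero; suc)
open import Data.Integer using (ℤ; +_; _+_; _-_; _*_; _<_)
open import Data.Maybe using (Maybe; just; nothing)
open import Data.List using (List; []; _∷_)
open import Data.List.Membership.Propositional using (_∈_)
open import Data.Product using (Σ; ∃; _×_; _,_)
open import Data.Sum using (_⊎_)
open import Data.Empty using (⊥)
open import Relation.Nullary using (¬_)
open import Relation.Binary.PropositionalEquality using (_≡_; _≢_)

Var : Set
Var = ℕ

Val : Set
Val = ℤ

-- locations are (integer) values, so that [e] makes sense
Loc : Set
Loc = ℤ

ResName : Set
ResName = ℕ

Store : Set
Store = Var → Val

record Heap : Set where
  constructor mkHeap
  field
    fun    : Loc → Maybe Val
    finite : Σ (List Loc) λ ls → ∀ l → fun l ≢ nothing → l ∈ ls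
open Heap public

_∈dom_ : Loc → Heap → Set
l ∈dom h = fun h l ≢ nothing

State : Set
State = Store × Heap

data Expr : Set where
  const : Val → Expr
  var   : Var → Expr
  plus minus times : Expr → Expr → Expr

⟦_⟧e : Expr → Store → Val
⟦ const v ⟧e s = v
⟦ var x ⟧e s = s x
⟦ plus e e' ⟧e s = ⟦ e ⟧e s + ⟦ e' ⟧e s
⟦ minus e e' ⟧e s = ⟦ e ⟧e s - ⟦ e' ⟧e s
⟦ times e e' ⟧e s = ⟦ e ⟧e s * ⟦ e' ⟧e s

data BExpr : Set where
  btrue  : BExpr
  bfalse : BExpr
  beq    : Expr → Expr → BExpr
  blt    : Expr → Expr → BExpr
  bnot   : BExpr → BExpr
  band   : BExpr → BExpr → BExpr

-- Basic commands and their standard semantics (only the abort part of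
-- [c](s,h) is needed for the statement)

data BasicCmd : Set where
  assign  : Var → Expr → BasicCmd
  load    : Var → Expr → BasicCmd
  store   : Expr → Expr → BasicCmd
  cons    : Var → List Expr → BasicCmd
  dispose : Expr → BasicCmd

-- [c](s,h) = abort : exactly the memory faults of the standard semantics
-- (assignment and cons never abort; load/store/dispose abort iff the
-- address is not allocated).
data BasicAborts : BasicCmd → State → Set where
  load-abort    : ∀ {x e s h} → ¬ (⟦ e ⟧e s ∈dom h) → BasicAborts (load x e) (s , h)
  store-abort   : ∀ {e e' s h} → ¬ (⟦ e ⟧e s ∈dom h) → BasicAborts (store e e') (s , h)
  dispose-abort : ∀ {e s h} → ¬ (⟦ e ⟧e s ∈dom h) → BasicAborts (dispose e) (s , h)

data Cmd : Set where
  skip     : Cmd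
  basic    : BasicCmd → Cmd
  _︔_      : Cmd → Cmd → Cmd
  if_then_else_ : BExpr → Cmd → Cmd → Cmd
  while_loop_ : BExpr → Cmd → Cmd
  resource_inside_ : ResName → Cmd → Cmd
  withr_when_run_ : ResName → BExpr → Cmd → Cmd
  _∥_      : Cmd → Cmd → Cmd
  within_run_ : ResName → Cmd → Cmd

RSet : Set₁
RSet = ResName → Set

_∪_ : RSet → RSet → RSet
(A ∪ B) r = A r ⊎ B r

_∖[_] : RSet → ResName → RSet
(A ∖[ r ]) x = A x × x ≢ r

_⟨+_⟩ : RSet → ResName → RSet
(A ⟨+ r ⟩) x = A x ⊎ x ≡ r

Disjoint : RSet → RSet → Set
Disjoint A B = ∀ r → A r → B r → ⊥

RTriple : Set₁
RTriple = RSet × RSet × RSet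

IsResConfig : RTriple → Set
IsResConfig (O , L , D) = Disjoint O L × Disjoint O D × Disjoint L D

_∈ρ_ : ResName → RTriple → Set
r ∈ρ (O , L , D) = O r ⊎ L r ⊎ D r

_∖ρ_ : RTriple → ResName → RTriple
(O , L , D) ∖ρ r = (O ∖[ r ]) , (L ∖[ r ]) , (D ∖[ r ])

Locked : Cmd → RSet
Locked (C₁ ︔ C₂) r = Locked C₁ r
Locked (C₁ ∥ C₂) r = Locked C₁ r ⊎ Locked C₂ r
Locked (resource r' inside C) r = Locked C r × r ≢ r'
Locked (within r' run C) r = Locked C r ⊎ r ≡ r'
Locked _ r = ⊥

data _,_,_,_→ₚabort : Cmd → Store → Heap → RTriple → Set₁ where
  RA  : ∀ {r C s h ρ} → r ∈ρ ρ → (resource r inside C) , s , h , ρ →ₚabort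
  WA  : ∀ {r B C s h ρ} → ¬ (r ∈ρ ρ) → (withr r when B run C) , s , h , ρ →ₚabort
  RA1 : ∀ {r C s h O L D} → Locked C r →
        C , s , h , ((O ⟨+ r ⟩) , L , D) →ₚabort →
        (resource r inside C) , s , h , (O , L , D) →ₚabort
  RA2 : ∀ {r C s h O L D} → ¬ Locked C r →
        C , s , h , (O , L , (D ⟨+ r ⟩)) →ₚabort →
        (resource r inside C) , s , h , (O , L , D) →ₚabort
  BCA : ∀ {c s h ρ} → BasicAborts c (s , h) → basic c , s , h , ρ →ₚabort
  SA  : ∀ {C₁ C₂ s h ρ} → C₁ , s , h , ρ →ₚabort → (C₁ ︔ C₂) , s , h , ρ →ₚabort
  WA1 : ∀ {r C s h ρ} → C , s , h , (ρ ∖ρ r) →ₚabort →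
        (within r run C) , s , h , ρ →ₚabort
  WA2 : ∀ {r C s h O L D} → ¬ O r → (within r run C) , s , h , (O , L , D) →ₚabort
  PA1 : ∀ {C₁ C₂ s h ρ} → C₁ , s , h , ρ →ₚabort → (C₁ ∥ C₂) , s , h , ρ →ₚabort
  PA2 : ∀ {C₁ C₂ s h ρ} → C₂ , s , h , ρ →ₚabort → (C₁ ∥ C₂) , s , h , ρ →ₚabort

-- Aborting depends on a configuration only through the set of resources it
-- mentions (rules RA and WA) and through the owned resources that `within`
-- requires (WA2); the rules RA1, RA2 and WA1 modify O, D and ρ in ways that
-- preserve both observations. Hence an aborting derivation from (O₁ ∪ O₂, L, D)
-- transfers to (O₁, L ∪ O₂, D), which mentions the same resources and owns
-- fewer.
module Submission where

open import Defs
open import Data.Product using (_,_; proj₁; proj₂)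
open import Data.Sum using (inj₁; inj₂)
open import Relation.Nullary using (¬_)
open import Relation.Unary using (_⊆_; _≐_)
open import Relation.Unary.Properties using (≐-sym; ≐-trans)

members : RTriple → RSet
members ρ r = r ∈ρ ρ

owned : RTriple → RSet
owned = proj₁

⟨+⟩-mono-⊆ : ∀ {A B : RSet} {r} → A ⊆ B → (A ⟨+ r ⟩) ⊆ (B ⟨+ r ⟩)
⟨+⟩-mono-⊆ A⊆B (inj₁ a)   = inj₁ (A⊆B a)
⟨+⟩-mono-⊆ A⊆B (inj₂ x≡r) = inj₂ x≡r

⟨+⟩-resp-≐ : ∀ {A B : RSet} {r} → A ≐ B → (A ⟨+ r ⟩) ≐ (B ⟨+ r ⟩)
⟨+⟩-resp-≐ (A⊆B , B⊆A) = ⟨+⟩-mono-⊆ (λ {x} → A⊆B {x}) , ⟨+⟩-mono-⊆ (λ {x} → B⊆A {x})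

∖[]-mono-⊆ : ∀ {A B : RSet} {r} → A ⊆ B → (A ∖[ r ]) ⊆ (B ∖[ r ])
∖[]-mono-⊆ A⊆B (a , x≢r) = A⊆B a , x≢r

∖[]-resp-≐ : ∀ {A B : RSet} {r} → A ≐ B → (A ∖[ r ]) ≐ (B ∖[ r ])
∖[]-resp-≐ (A⊆B , B⊆A) = ∖[]-mono-⊆ (λ {x} → A⊆B {x}) , ∖[]-mono-⊆ (λ {x} → B⊆A {x})

members-⟨+⟩ᴼ : ∀ {O L D r} →
  members ((O ⟨+ r ⟩) , L , D) ≐ (members (O , L , D) ⟨+ r ⟩)
members-⟨+⟩ᴼ =
    (λ { (inj₁ (inj₁ o)) → inj₁ (inj₁ o)
       ; (inj₁ (inj₂ x≡r)) → inj₂ x≡r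
       ; (inj₂ x∈LD) → inj₁ (inj₂ x∈LD)
       })
  , (λ { (inj₁ (inj₁ o)) → inj₁ (inj₁ o)
       ; (inj₁ (inj₂ x∈LD)) → inj₂ x∈LD
       ; (inj₂ x≡r) → inj₁ (inj₂ x≡r)
       })

members-⟨+⟩ᴰ : ∀ {O L D r} →
  members (O , L , (D ⟨+ r ⟩)) ≐ (members (O , L , D) ⟨+ r ⟩)
members-⟨+⟩ᴰ =
    (λ { (inj₁ o) → inj₁ (inj₁ o)
       ; (inj₂ (inj₁ l)) → inj₁ (inj₂ (inj₁ l))
       ; (inj₂ (inj₂ (inj₁ d))) → inj₁ (inj₂ (inj₂ d))
       ; (inj₂ (inj₂ (inj₂ x≡r))) → inj₂ x≡r
       })
  , (λ { (inj₁ (inj₁ o)) → inj₁ o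
       ; (inj₁ (inj₂ (inj₁ l))) → inj₂ (inj₁ l)
       ; (inj₁ (inj₂ (inj₂ d))) → inj₂ (inj₂ (inj₁ d))
       ; (inj₂ x≡r) → inj₂ (inj₂ (inj₂ x≡r))
       })

members-∖ρ : ∀ {ρ r} → members (ρ ∖ρ r) ≐ (members ρ ∖[ r ])
members-∖ρ {O , L , D} =
    (λ { (inj₁ (o , x≢r)) → inj₁ o , x≢r
       ; (inj₂ (inj₁ (l , x≢r))) → inj₂ (inj₁ l) , x≢r
       ; (inj₂ (inj₂ (d , x≢r))) → inj₂ (inj₂ d) , x≢r
       })
  , (λ { (inj₁ o , x≢r) → inj₁ (o , x≢r)
       ; (inj₂ (inj₁ l) , x≢r) → inj₂ (inj₁ (l , x≢r))
       ; (inj₂ (inj₂ d) , x≢r) → inj₂ (inj₂ (d , x≢r))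
       })

record _≼_ (ρ ρ' : RTriple) : Set where
  field
    members-≐ : members ρ ≐ members ρ'
    owned-⊇   : owned ρ' ⊆ owned ρ
open _≼_

≼-⟨+⟩ᴼ : ∀ {O L D O' L' D' r} → (O , L , D) ≼ (O' , L' , D') →
  ((O ⟨+ r ⟩) , L , D) ≼ ((O' ⟨+ r ⟩) , L' , D')
≼-⟨+⟩ᴼ ρ≼ρ' = record
  { members-≐ = ≐-trans members-⟨+⟩ᴼ
                  (≐-trans (⟨+⟩-resp-≐ (members-≐ ρ≼ρ')) (≐-sym members-⟨+⟩ᴼ))
  ; owned-⊇   = ⟨+⟩-mono-⊆ (λ {x} → owned-⊇ ρ≼ρ' {x})
  }

≼-⟨+⟩ᴰ : ∀ {O L D O' L' D' r} → (O , L , D) ≼ (O' , L' , D') →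
  (O , L , (D ⟨+ r ⟩)) ≼ (O' , L' , (D' ⟨+ r ⟩))
≼-⟨+⟩ᴰ ρ≼ρ' = record
  { members-≐ = ≐-trans members-⟨+⟩ᴰ
                  (≐-trans (⟨+⟩-resp-≐ (members-≐ ρ≼ρ')) (≐-sym members-⟨+⟩ᴰ))
  ; owned-⊇   = owned-⊇ ρ≼ρ'
  }

≼-∖ρ : ∀ {ρ ρ' r} → ρ ≼ ρ' → (ρ ∖ρ r) ≼ (ρ' ∖ρ r)
≼-∖ρ {_ , _ , _} {_ , _ , _} ρ≼ρ' = record
  { members-≐ = ≐-trans members-∖ρ
                  (≐-trans (∖[]-resp-≐ (members-≐ ρ≼ρ')) (≐-sym members-∖ρ))
  ; owned-⊇   = ∖[]-mono-⊆ (λ {x} → owned-⊇ ρ≼ρ' {x})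
  }

abort-mono-≼ : ∀ {C s h ρ ρ'} → ρ ≼ ρ' →
  C , s , h , ρ →ₚabort → C , s , h , ρ' →ₚabort
abort-mono-≼ ρ≼ρ' (RA r∈ρ)     = RA (proj₁ (members-≐ ρ≼ρ') r∈ρ)
abort-mono-≼ ρ≼ρ' (WA r∉ρ)     = WA (λ r∈ρ' → r∉ρ (proj₂ (members-≐ ρ≼ρ') r∈ρ'))
abort-mono-≼ ρ≼ρ' (RA1 lk ab)  = RA1 lk (abort-mono-≼ (≼-⟨+⟩ᴼ ρ≼ρ') ab)
abort-mono-≼ ρ≼ρ' (RA2 nlk ab) = RA2 nlk (abort-mono-≼ (≼-⟨+⟩ᴰ ρ≼ρ') ab)
abort-mono-≼ ρ≼ρ' (BCA b)      = BCA b
abort-mono-≼ ρ≼ρ' (SA ab)      = SA (abort-mono-≼ ρ≼ρ' ab)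
abort-mono-≼ ρ≼ρ' (WA1 ab)     = WA1 (abort-mono-≼ (≼-∖ρ ρ≼ρ') ab)
abort-mono-≼ ρ≼ρ' (WA2 r∉O)    = WA2 (λ r∈O' → r∉O (owned-⊇ ρ≼ρ' r∈O'))
abort-mono-≼ ρ≼ρ' (PA1 ab)     = PA1 (abort-mono-≼ ρ≼ρ' ab)
abort-mono-≼ ρ≼ρ' (PA2 ab)     = PA2 (abort-mono-≼ ρ≼ρ' ab)

owned-to-locked-≼ : ∀ {O₁ O₂ L D} → ((O₁ ∪ O₂) , L , D) ≼ (O₁ , (L ∪ O₂) , D)
owned-to-locked-≼ = record
  { members-≐ =
      (λ { (inj₁ (inj₁ o₁)) → inj₁ o₁
         ; (inj₁ (inj₂ o₂)) → inj₂ (inj₁ (inj₂ o₂))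
         ; (inj₂ (inj₁ l))  → inj₂ (inj₁ (inj₁ l))
         ; (inj₂ (inj₂ d))  → inj₂ (inj₂ d)
         })
    , (λ { (inj₁ o₁)              → inj₁ (inj₁ o₁)
         ; (inj₂ (inj₁ (inj₁ l)))  → inj₂ (inj₁ l)
         ; (inj₂ (inj₁ (inj₂ o₂))) → inj₁ (inj₂ o₂)
         ; (inj₂ (inj₂ d))         → inj₂ (inj₂ d)
         })
  ; owned-⊇ = inj₁
  }

proposition6 : (C : Cmd) (s : Store) (h : Heap) (O₁ O₂ L D : RSet) →
    IsResConfig ((O₁ ∪ O₂) , L , D) →
    IsResConfig (O₁ , (L ∪ O₂) , D) →
    ¬ (C , s , h , (O₁ , (L ∪ O₂) , D) →ₚabort) →
    ¬ (C , s , h , ((O₁ ∪ O₂) , L , D) →ₚabort)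
proposition6 C s h O₁ O₂ L D _ _ safe aborts = safe (abort-mono-≼ owned-to-locked-≼ aborts)
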